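{- Let $k\ge 1$ and let $G$ be a graph with $\delta(G)\ge k$. Then $\gamma_{\times k,t}^{r}(G)=k+1$ if and only if $G=K_{k+1}$ or $G=F\circ_k K_{k+1}$ for some graph $F$ with $\delta(F)\ge k$.
   Context: All graphs are finite and simple; $N(x)$ denotes the open neighborhood of $x$ and $\delta$ the minimum degree. For an integer $k\ge 1$, a set $S\subseteq V(G)$ is a $k$-tuple total dominating set of $G$ if $|N(x)\cap S|\ge k$ for every $x\in V(G)$. It is a $k$-tuple total restrained dominating set (kTRDS) if moreover every vertex $x\in V(G)\setminus S$ is adjacent to at least $k$ vertices of $V(G)\setminus S$. For a graph with $\delta(G)\ge k$, $\gamma_{\times k,t}^{r}(G)$ denotes the minimum cardinality of a kTRDS of $G$. For graphs $F$ and $H$ with $|V(H)|\ge k$, the $k$-join $F\circ_k H$ denotes a graph obtained from the disjoint union of $F$ and $H$ by joining each vertex of $F$ to at least $k$ vertices of $H$ (no other edges added); "$G=F\circ_k H$" means $G$ is (isomorphic to) such a graph. -}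

module Defs where

open import Data.Nat using (ℕ; _≤_; _+_)
open import Data.Bool using (Bool; true; false; not)
open import Data.Fin using (Fin; _↑ˡ_; _↑ʳ_; _≟_)
open import Data.Fin.Subset using (Subset; _∩_; ∁; ∣_∣; _∉_)
open import Data.Vec using (tabulate)
open import Data.Product using (Σ; ∃; _×_)
open import Relation.Binary.PropositionalEquality using (_≡_)
open import Relation.Nullary.Decidable using (⌊_⌋)

record Graph (n : ℕ) : Set where
  field
    adj    : Fin n → Fin n → Bool
    adj-sym    : ∀ i j → adj i j ≡ adj j i
    adj-irrefl : ∀ i → adj i i ≡ false
open Graph public

N : ∀ {n} → Graph n → Fin n → Subset n
N G x = tabulate (adj G x)

MinDegGE : ∀ {n} → Graph n → ℕ → Set
MinDegGE G k = ∀ x → k ≤ ∣ N G x ∣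

IsKTRDS : ∀ {n} → Graph n → ℕ → Subset n → Set
IsKTRDS G k S =
  (∀ x → k ≤ ∣ N G x ∩ S ∣) ×
  (∀ x → x ∉ S → k ≤ ∣ N G x ∩ ∁ S ∣)

KTRDNumberIs : ∀ {n} → Graph n → ℕ → ℕ → Set
KTRDNumberIs G k m =
  (Σ _ λ S → IsKTRDS G k S × ∣ S ∣ ≡ m) ×
  (∀ S → IsKTRDS G k S → m ≤ ∣ S ∣)

K : (m : ℕ) → Graph m
K m = record { adj = λ i j → not ⌊ i ≟ j ⌋ ; adj-sym = symK ; adj-irrefl = irrK }
  where
  open import Relation.Binary.PropositionalEquality using (refl; sym)
  open import Relation.Nullary using (yes; no)
  symK : ∀ i j → not ⌊ i ≟ j ⌋ ≡ not ⌊ j ≟ i ⌋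
  symK i j with i ≟ j | j ≟ i
  ... | yes _ | yes _ = refl
  ... | no _  | no _  = refl
  ... | yes p | no q  with q (sym p)
  ... | ()
  symK i j | no q | yes p with q (sym p)
  ... | ()
  irrK : ∀ i → not ⌊ i ≟ i ⌋ ≡ false
  irrK i with i ≟ i
  ... | yes _ = refl
  ... | no q with q refl
  ... | ()

record _≅_ {n m : ℕ} (G : Graph n) (H : Graph m) : Set where
  field
    to      : Fin n → Fin m
    from    : Fin m → Fin n
    from-to : ∀ x → from (to x) ≡ x
    to-from : ∀ y → to (from y) ≡ y
    adj-iso : ∀ x y → adj H (to x) (to y) ≡ adj G x y

-- J (on Fin (p + q), F-vertices first, then H-vertices) is a k-join F ∘_k H:
-- induced subgraphs are F and H, every F-vertex has ≥ k neighbours in H,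
-- and no other edges (the F–H edges are the only added ones).
IsKJoin : ∀ {p q} → ℕ → Graph p → Graph q → Graph (p + q) → Set
IsKJoin {p} {q} k F H J =
  (k ≤ q) ×
  (∀ i j → adj J (i ↑ˡ q) (j ↑ˡ q) ≡ adj F i j) ×
  (∀ i j → adj J (p ↑ʳ i) (p ↑ʳ j) ≡ adj H i j) ×
  (∀ i → k ≤ ∣ tabulate (λ j → adj J (i ↑ˡ q) (p ↑ʳ j)) ∣)

IsKJoinOf : ∀ {n p q} → ℕ → Graph n → Graph p → Graph q → Set
IsKJoinOf {n} {p} {q} k G F H = Σ (Graph (p + q)) λ J → IsKJoin k F H J × (G ≅ J)

-- A vertex x₀ has a neighbour y ∈ S, and the ≥ k neighbours of y in S lie in S - y, so every
-- kTRDS S has |S| ≥ k + 1 (this needs k ≥ 1). If |S| = k + 1, the k neighbours in S of any x ∈ S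
-- must be all of S - x, so S spans a K_{k+1}; the vertices outside S then have ≥ k neighbours in S
-- (total domination) and ≥ k outside S (restraint), which says precisely that G = F ∘_k K_{k+1}
-- with F = G - S and δ(F) ≥ k. Conversely, the clique of F ∘_k K_{k+1} is a kTRDS of size k + 1.
-- K_{k+1} itself is the k-join K₀ ∘_k K_{k+1}, so it needs no separate treatment.
module Submission where

open import Defs
open import Data.Nat using (ℕ; zero; suc; _+_; _≤_; _<_; s≤s)
open import Data.Nat.Properties using (+-0-commutativeMonoid; +-assoc; +-identityʳ; n≤1+n; ≤-trans; <-irrefl; module ≤-Reasoning)
open import Data.Bool using (Bool; true; false; not; _∧_)
open import Data.Bool.Properties using (∧-zeroʳ; ∧-identityʳ)
open import Data.Fin using (Fin; zero; suc; _↑ˡ_; _↑ʳ_; splitAt; _≟_)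
open import Data.Fin.Properties using (+↔⊎; suc-injective; splitAt-↑ˡ; splitAt-↑ʳ; join-splitAt; ↑ʳ-injective)
open import Data.Fin.Subset using (Subset; _∈_; _∉_; _∩_; ∁; ∣_∣; _-_; _⊆_; Nonempty)
open import Data.Fin.Subset.Properties
  using (nonempty?; Empty-unique; ∣⊥∣≡0; p⊆q⇒∣p∣≤∣q∣; x∈p⇒∣p-x∣<∣p∣; x∈p∧x≢y⇒x∈p-y; x∈p∩q⁻)
open import Data.Vec using ([]; _∷_; tabulate; lookup)
open import Data.Vec.Properties using (lookup∘tabulate; tabulate∘lookup; tabulate-∘; tabulate-cong; []=⇒lookup; lookup⇒[]=)
open import Data.Product using (Σ; _×_; _,_; proj₁; proj₂)
open import Data.Sum using (_⊎_; inj₁; inj₂; [_,_]′; map₁)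
open import Data.Sum.Algebra using (⊎-comm)
open import Function using (_∘_; id; const)
open import Function.Bundles using (_⇔_; mk⇔; _↔_; Inverse; mk↔ₛ′)
open import Function.Properties.Inverse using (↔-sym; ↔-trans)
open import Data.Fin.Permutation using (Permutation; permutation; _⟨$⟩ʳ_; _⟨$⟩ˡ_; inverseˡ; inverseʳ)
open import Relation.Binary.PropositionalEquality using (_≡_; _≢_; refl; sym; trans; cong; cong₂; subst; module ≡-Reasoning)
open import Relation.Nullary using (yes; no; contradiction)
open import Relation.Nullary.Decidable using (⌊⌋-map′)
import Algebra.Properties.CommutativeMonoid.Sum as CommutativeMonoidSum

open CommutativeMonoidSum +-0-commutativeMonoid using (sum; sum-permute)

private
  variable
    m n p q k : ℕ

∣∷∣ : ∀ b (P : Subset n) → ∣ b ∷ P ∣ ≡ ∣ b ∷ [] ∣ + ∣ P ∣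
∣∷∣ true  P = refl
∣∷∣ false P = refl

∣tabulate∣≡sum : (f : Fin n → Bool) → ∣ tabulate f ∣ ≡ sum (λ i → ∣ f i ∷ [] ∣)
∣tabulate∣≡sum {zero}  f = refl
∣tabulate∣≡sum {suc n} f =
  trans (∣∷∣ (f zero) (tabulate (f ∘ suc))) (cong (∣ f zero ∷ [] ∣ +_) (∣tabulate∣≡sum (f ∘ suc)))

∣tabulate∣-permute : (π : Permutation m n) (f : Fin n → Bool) →
  ∣ tabulate f ∣ ≡ ∣ tabulate (f ∘ (π ⟨$⟩ʳ_)) ∣
∣tabulate∣-permute π f =
  trans (∣tabulate∣≡sum f) (trans (sum-permute _ π) (sym (∣tabulate∣≡sum (f ∘ (π ⟨$⟩ʳ_)))))

∣tabulate∣-+ : ∀ p (f : Fin (p + q) → Bool) →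
  ∣ tabulate f ∣ ≡ ∣ tabulate (f ∘ (_↑ˡ q)) ∣ + ∣ tabulate (f ∘ (p ↑ʳ_)) ∣
∣tabulate∣-+ zero    f = refl
∣tabulate∣-+ {q} (suc p) f = begin
  ∣ tabulate f ∣                                         ≡⟨ ∣∷∣ (f zero) (tabulate (f ∘ suc)) ⟩
  ∣ f zero ∷ [] ∣ + ∣ tabulate (f ∘ suc) ∣               ≡⟨ cong (∣ f zero ∷ [] ∣ +_) (∣tabulate∣-+ p (f ∘ suc)) ⟩
  ∣ f zero ∷ [] ∣ + (∣ tabulate (f ∘ suc ∘ (_↑ˡ q)) ∣ + ∣ tabulate (f ∘ suc ∘ (p ↑ʳ_)) ∣)
                                                         ≡⟨ +-assoc ∣ f zero ∷ [] ∣ ∣ tabulate (f ∘ suc ∘ (_↑ˡ q)) ∣ _ ⟨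
  ∣ f zero ∷ [] ∣ + ∣ tabulate (f ∘ suc ∘ (_↑ˡ q)) ∣ + ∣ tabulate (f ∘ suc ∘ (p ↑ʳ_)) ∣
                                                         ≡⟨ cong (_+ ∣ tabulate (f ∘ suc ∘ (p ↑ʳ_)) ∣) (∣∷∣ (f zero) (tabulate (f ∘ suc ∘ (_↑ˡ q)))) ⟨
  ∣ tabulate (f ∘ (_↑ˡ q)) ∣ + ∣ tabulate (f ∘ (suc p ↑ʳ_)) ∣ ∎
  where open ≡-Reasoning

∣tabulate-false∣ : ∣ tabulate {n = n} (const false) ∣ ≡ 0
∣tabulate-false∣ {zero}  = refl
∣tabulate-false∣ {suc n} = ∣tabulate-false∣ {n}

∣tabulate-true∣ : ∣ tabulate {n = n} (const true) ∣ ≡ n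
∣tabulate-true∣ {zero}  = refl
∣tabulate-true∣ {suc n} = cong suc (∣tabulate-true∣ {n})

tabulate-∩ : (f g : Fin n → Bool) → tabulate f ∩ tabulate g ≡ tabulate (λ x → f x ∧ g x)
tabulate-∩ {zero}  f g = refl
tabulate-∩ {suc n} f g = cong (f zero ∧ g zero ∷_) (tabulate-∩ (f ∘ suc) (g ∘ suc))

∁-tabulate : (f : Fin n → Bool) → ∁ (tabulate f) ≡ tabulate (not ∘ f)
∁-tabulate f = sym (tabulate-∘ not f)

∈tabulate⁺ : {f : Fin n → Bool} {x : Fin n} → f x ≡ true → x ∈ tabulate f
∈tabulate⁺ {f = f} {x} fx = lookup⇒[]= x (tabulate f) (trans (lookup∘tabulate f x) fx)

∈tabulate⁻ : {f : Fin n → Bool} {x : Fin n} → x ∈ tabulate f → f x ≡ true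
∈tabulate⁻ {f = f} {x} x∈ = trans (sym (lookup∘tabulate f x)) ([]=⇒lookup x∈)

nonempty : {P : Subset n} → 1 ≤ ∣ P ∣ → Nonempty P
nonempty {n} {P} 1≤∣P∣ with nonempty? P
... | yes ne = ne
... | no empty = contradiction (subst (1 ≤_) (trans (cong ∣_∣ (Empty-unique empty)) (∣⊥∣≡0 n)) 1≤∣P∣) λ ()

IsKTupleTotalDominating : Graph n → ℕ → Subset n → Set
IsKTupleTotalDominating G k S = ∀ x → k ≤ ∣ N G x ∩ S ∣

∈N∩⇒∈- : (G : Graph n) {x y : Fin n} {S : Subset n} → y ∈ N G x ∩ S → y ∈ S - x
∈N∩⇒∈- G {x} {y} {S} y∈N∩S = x∈p∧x≢y⇒x∈p-y (proj₂ y∈N×S) y≢x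
  where
  y∈N×S = x∈p∩q⁻ (N G x) S y∈N∩S
  y≢x : y ≢ x
  y≢x refl = contradiction (trans (sym (∈tabulate⁻ (proj₁ y∈N×S))) (adj-irrefl G x)) λ ()

kTupleTotalDominating⇒k<∣S∣ : (G : Graph n) {S : Subset n} → 1 ≤ k → Fin n →
  IsKTupleTotalDominating G k S → k < ∣ S ∣
kTupleTotalDominating⇒k<∣S∣ {k = k} G {S} 1≤k x₀ dom with nonempty (≤-trans 1≤k (dom x₀))
... | y , y∈N∩S = begin-strict
  k                 ≤⟨ dom y ⟩
  ∣ N G y ∩ S ∣     ≤⟨ p⊆q⇒∣p∣≤∣q∣ (∈N∩⇒∈- G) ⟩
  ∣ S - y ∣         <⟨ x∈p⇒∣p-x∣<∣p∣ (proj₂ (x∈p∩q⁻ (N G x₀) S y∈N∩S)) ⟩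
  ∣ S ∣             ∎
  where open ≤-Reasoning

kTupleTotalDominating∧∣S∣≡1+k⇒clique : (G : Graph n) {S : Subset n} {x y : Fin n} →
  IsKTupleTotalDominating G k S → ∣ S ∣ ≡ suc k → x ∈ S → y ∈ S → x ≢ y → adj G x y ≡ true
kTupleTotalDominating∧∣S∣≡1+k⇒clique {k = k} G {S} {x} {y} dom ∣S∣≡1+k x∈S y∈S x≢y
  with adj G x y in xy
... | true  = refl
... | false = contradiction 2+k≤1+k (<-irrefl refl)
  where
  open ≤-Reasoning
  N∩S⊆S-x-y : N G x ∩ S ⊆ S - x - y
  N∩S⊆S-x-y z∈ = x∈p∧x≢y⇒x∈p-y (∈N∩⇒∈- G z∈) λ { refl →
    contradiction (trans (sym (∈tabulate⁻ (proj₁ (x∈p∩q⁻ (N G x) S z∈)))) xy) λ () }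
  2+k≤1+k : suc (suc k) ≤ suc k
  2+k≤1+k = begin
    suc (suc k)               ≤⟨ s≤s (s≤s (dom x)) ⟩
    suc (suc ∣ N G x ∩ S ∣)   ≤⟨ s≤s (s≤s (p⊆q⇒∣p∣≤∣q∣ N∩S⊆S-x-y)) ⟩
    suc (suc ∣ S - x - y ∣)   ≤⟨ s≤s (x∈p⇒∣p-x∣<∣p∣ (x∈p∧x≢y⇒x∈p-y y∈S (x≢y ∘ sym))) ⟩
    suc ∣ S - x ∣             ≤⟨ x∈p⇒∣p-x∣<∣p∣ x∈S ⟩
    ∣ S ∣                     ≡⟨ ∣S∣≡1+k ⟩
    suc k                     ∎

comap : (Fin m → Fin n) → Graph n → Graph m
comap f G = record
  { adj        = λ i j → adj G (f i) (f j)
  ; adj-sym    = λ i j → adj-sym G (f i) (f j)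
  ; adj-irrefl = λ i → adj-irrefl G (f i)
  }

≅-comap : (π : Permutation n m) (G : Graph n) → G ≅ comap (π ⟨$⟩ˡ_) G
≅-comap π G = record
  { to      = π ⟨$⟩ʳ_
  ; from    = π ⟨$⟩ˡ_
  ; from-to = λ x → inverseˡ π
  ; to-from = λ y → inverseʳ π
  ; adj-iso = λ x y → cong₂ (adj G) (inverseˡ π) (inverseˡ π)
  }

≅-sym : {G : Graph n} {H : Graph m} → G ≅ H → H ≅ G
≅-sym {G = G} {H} I = record
  { to      = from
  ; from    = to
  ; from-to = to-from
  ; to-from = from-to
  ; adj-iso = λ x y →
      trans (sym (adj-iso (from x) (from y))) (cong₂ (adj H) (to-from x) (to-from y))
  }
  where open _≅_ I

vertexPermutation : {G : Graph n} {H : Graph m} → G ≅ H → Permutation n m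
vertexPermutation I = permutation to from to-from from-to
  where open _≅_ I

∣tabulate∣-≅ : {G : Graph n} {H : Graph m} (I : G ≅ H) (t : Fin m → Bool) →
  ∣ tabulate (t ∘ _≅_.to I) ∣ ≡ ∣ tabulate t ∣
∣tabulate∣-≅ I t = sym (∣tabulate∣-permute (vertexPermutation I) t)

∣N∩tabulate∣-≅ : {G : Graph n} {H : Graph m} (I : G ≅ H) (t : Fin m → Bool) (x : Fin n) →
  ∣ N G x ∩ tabulate (t ∘ _≅_.to I) ∣ ≡ ∣ N H (_≅_.to I x) ∩ tabulate t ∣
∣N∩tabulate∣-≅ {G = G} {H} I t x = begin
  ∣ N G x ∩ tabulate (t ∘ to) ∣                          ≡⟨ cong ∣_∣ (tabulate-∩ (adj G x) (t ∘ to)) ⟩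
  ∣ tabulate (λ y → adj G x y ∧ t (to y)) ∣              ≡⟨ ∣tabulate∣-permute (↔-sym (vertexPermutation I)) _ ⟩
  ∣ tabulate (λ v → adj G x (from v) ∧ t (to (from v))) ∣ ≡⟨ cong ∣_∣ (tabulate-cong along-to) ⟩
  ∣ tabulate (λ v → adj H (to x) v ∧ t v) ∣              ≡⟨ cong ∣_∣ (tabulate-∩ (adj H (to x)) t) ⟨
  ∣ N H (to x) ∩ tabulate t ∣                            ∎
  where
  open _≅_ I
  open ≡-Reasoning
  along-to : ∀ v → adj G x (from v) ∧ t (to (from v)) ≡ adj H (to x) v ∧ t v
  along-to v = cong₂ _∧_
    (trans (sym (adj-iso x (from v))) (cong (adj H (to x)) (to-from v)))
    (cong t (to-from v))

isKTRDS-≅ : {G : Graph n} {H : Graph m} (I : G ≅ H) {t : Fin m → Bool} →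
  IsKTRDS H k (tabulate t) → IsKTRDS G k (tabulate (t ∘ _≅_.to I))
isKTRDS-≅ {k = k} {G} {H} I {t} (domH , restrH) = dom , restr
  where
  open _≅_ I
  open ≤-Reasoning
  dom : ∀ x → k ≤ ∣ N G x ∩ tabulate (t ∘ to) ∣
  dom x = begin
    k                               ≤⟨ domH (to x) ⟩
    ∣ N H (to x) ∩ tabulate t ∣     ≡⟨ ∣N∩tabulate∣-≅ I t x ⟨
    ∣ N G x ∩ tabulate (t ∘ to) ∣   ∎
  restr : ∀ x → x ∉ tabulate (t ∘ to) → k ≤ ∣ N G x ∩ ∁ (tabulate (t ∘ to)) ∣
  restr x x∉ = begin
    k                                      ≤⟨ restrH (to x) (x∉ ∘ ∈tabulate⁺ ∘ ∈tabulate⁻) ⟩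
    ∣ N H (to x) ∩ ∁ (tabulate t) ∣        ≡⟨ cong (λ T → ∣ N H (to x) ∩ T ∣) (∁-tabulate t) ⟩
    ∣ N H (to x) ∩ tabulate (not ∘ t) ∣    ≡⟨ ∣N∩tabulate∣-≅ I (not ∘ t) x ⟨
    ∣ N G x ∩ tabulate (not ∘ t ∘ to) ∣    ≡⟨ cong (λ T → ∣ N G x ∩ T ∣) (∁-tabulate (t ∘ to)) ⟨
    ∣ N G x ∩ ∁ (tabulate (t ∘ to)) ∣      ∎

isRight : {A B : Set} → A ⊎ B → Bool
isRight = [ const false , const true ]′

inRight : ∀ p {q} → Fin (p + q) → Bool
inRight p = isRight ∘ splitAt p

rightBlock : ∀ p q → Subset (p + q)
rightBlock p q = tabulate (inRight p)

data BlockView p q : Fin (p + q) → Set where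
  left  : (i : Fin p) → BlockView p q (i ↑ˡ q)
  right : (j : Fin q) → BlockView p q (p ↑ʳ j)

blockView : ∀ p (u : Fin (p + q)) → BlockView p q u
blockView {q} p u with splitAt p u | join-splitAt p q u
... | inj₁ i | refl = left i
... | inj₂ j | refl = right j

inRight-↑ˡ : ∀ p (i : Fin p) → inRight p (i ↑ˡ q) ≡ false
inRight-↑ˡ {q} p i = cong isRight (splitAt-↑ˡ p i q)

inRight-↑ʳ : ∀ p (j : Fin q) → inRight p (p ↑ʳ j) ≡ true
inRight-↑ʳ {q} p j = cong isRight (splitAt-↑ʳ p q j)

∣tabulate-∧-inRight∣ : ∀ p (g : Fin (p + q) → Bool) →
  ∣ tabulate (λ v → g v ∧ inRight p v) ∣ ≡ ∣ tabulate (g ∘ (p ↑ʳ_)) ∣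
∣tabulate-∧-inRight∣ {q} p g = begin
  ∣ tabulate (λ v → g v ∧ inRight p v) ∣
    ≡⟨ ∣tabulate∣-+ p (λ v → g v ∧ inRight p v) ⟩
  ∣ tabulate (λ i → g (i ↑ˡ q) ∧ inRight p (i ↑ˡ q)) ∣ + ∣ tabulate (λ j → g (p ↑ʳ j) ∧ inRight p (p ↑ʳ j)) ∣
    ≡⟨ cong₂ _+_ (cong ∣_∣ (tabulate-cong λ i → trans (cong (g (i ↑ˡ q) ∧_) (inRight-↑ˡ p i)) (∧-zeroʳ _)))
                 (cong ∣_∣ (tabulate-cong λ j → trans (cong (g (p ↑ʳ j) ∧_) (inRight-↑ʳ p j)) (∧-identityʳ _))) ⟩
  ∣ tabulate {n = p} (const false) ∣ + ∣ tabulate (g ∘ (p ↑ʳ_)) ∣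
    ≡⟨ cong (_+ ∣ tabulate (g ∘ (p ↑ʳ_)) ∣) (∣tabulate-false∣ {p}) ⟩
  ∣ tabulate (g ∘ (p ↑ʳ_)) ∣ ∎
  where open ≡-Reasoning

∣tabulate-∧-inLeft∣ : ∀ p (g : Fin (p + q) → Bool) →
  ∣ tabulate (λ v → g v ∧ not (inRight p v)) ∣ ≡ ∣ tabulate (g ∘ (_↑ˡ q)) ∣
∣tabulate-∧-inLeft∣ {q} p g = begin
  ∣ tabulate (λ v → g v ∧ not (inRight p v)) ∣
    ≡⟨ ∣tabulate∣-+ p (λ v → g v ∧ not (inRight p v)) ⟩
  ∣ tabulate (λ i → g (i ↑ˡ q) ∧ not (inRight p (i ↑ˡ q))) ∣ + ∣ tabulate (λ j → g (p ↑ʳ j) ∧ not (inRight p (p ↑ʳ j))) ∣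
    ≡⟨ cong₂ _+_ (cong ∣_∣ (tabulate-cong λ i → trans (cong (λ b → g (i ↑ˡ q) ∧ not b) (inRight-↑ˡ p i)) (∧-identityʳ _)))
                 (cong ∣_∣ (tabulate-cong λ j → trans (cong (λ b → g (p ↑ʳ j) ∧ not b) (inRight-↑ʳ p j)) (∧-zeroʳ _))) ⟩
  ∣ tabulate (g ∘ (_↑ˡ q)) ∣ + ∣ tabulate {n = q} (const false) ∣
    ≡⟨ cong (∣ tabulate (g ∘ (_↑ˡ q)) ∣ +_) (∣tabulate-false∣ {q}) ⟩
  ∣ tabulate (g ∘ (_↑ˡ q)) ∣ + 0
    ≡⟨ +-identityʳ _ ⟩
  ∣ tabulate (g ∘ (_↑ˡ q)) ∣ ∎
  where open ≡-Reasoning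

∣rightBlock∣ : ∀ p q → ∣ rightBlock p q ∣ ≡ q
∣rightBlock∣ p q = trans (∣tabulate-∧-inRight∣ p (const true)) (∣tabulate-true∣ {q})

∣N∩rightBlock∣ : ∀ p q (J : Graph (p + q)) (u : Fin (p + q)) →
  ∣ N J u ∩ rightBlock p q ∣ ≡ ∣ tabulate (λ j → adj J u (p ↑ʳ j)) ∣
∣N∩rightBlock∣ p q J u = trans (cong ∣_∣ (tabulate-∩ (adj J u) (inRight p))) (∣tabulate-∧-inRight∣ p (adj J u))

∣N∩∁rightBlock∣ : ∀ p q (J : Graph (p + q)) (u : Fin (p + q)) →
  ∣ N J u ∩ ∁ (rightBlock p q) ∣ ≡ ∣ tabulate (λ i → adj J u (i ↑ˡ q)) ∣
∣N∩∁rightBlock∣ p q J u = begin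
  ∣ N J u ∩ ∁ (rightBlock p q) ∣                  ≡⟨ cong (λ T → ∣ N J u ∩ T ∣) (∁-tabulate (inRight p)) ⟩
  ∣ N J u ∩ tabulate (not ∘ inRight p) ∣         ≡⟨ cong ∣_∣ (tabulate-∩ (adj J u) (not ∘ inRight p)) ⟩
  ∣ tabulate (λ v → adj J u v ∧ not (inRight p v)) ∣ ≡⟨ ∣tabulate-∧-inLeft∣ p (adj J u) ⟩
  ∣ tabulate (λ i → adj J u (i ↑ˡ q)) ∣           ∎
  where open ≡-Reasoning

K-regular : (j : Fin (suc n)) → ∣ N (K (suc n)) j ∣ ≡ n
K-regular {n}     zero    = ∣tabulate-true∣ {n}
K-regular {suc n} (suc j) =
  cong suc (trans (cong ∣_∣ (tabulate-cong λ x → cong not (⌊⌋-map′ (cong suc) suc-injective (j ≟ x)))) (K-regular j))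

kJoin⇒isKTRDS-rightBlock : ∀ p (F : Graph p) (J : Graph (p + suc k)) →
  MinDegGE F k → IsKJoin k F (K (suc k)) J → IsKTRDS J k (rightBlock p (suc k))
kJoin⇒isKTRDS-rightBlock {k} p F J δF≥k (_ , J[F] , J[K] , F→K) = dom , restr
  where
  open ≤-Reasoning
  dom : ∀ u → k ≤ ∣ N J u ∩ rightBlock p (suc k) ∣
  dom u with blockView p u
  ... | left i = subst (k ≤_) (sym (∣N∩rightBlock∣ p (suc k) J (i ↑ˡ suc k))) (F→K i)
  ... | right j = begin
    k                                                  ≡⟨ K-regular j ⟨
    ∣ N (K (suc k)) j ∣                                ≡⟨ cong ∣_∣ (tabulate-cong (J[K] j)) ⟨
    ∣ tabulate (λ j′ → adj J (p ↑ʳ j) (p ↑ʳ j′)) ∣     ≡⟨ ∣N∩rightBlock∣ p (suc k) J (p ↑ʳ j) ⟨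
    ∣ N J (p ↑ʳ j) ∩ rightBlock p (suc k) ∣            ∎
  restr : ∀ u → u ∉ rightBlock p (suc k) → k ≤ ∣ N J u ∩ ∁ (rightBlock p (suc k)) ∣
  restr u u∉ with blockView p u
  ... | left i = begin
    k                                                  ≤⟨ δF≥k i ⟩
    ∣ N F i ∣                                          ≡⟨ cong ∣_∣ (tabulate-cong (J[F] i)) ⟨
    ∣ tabulate (λ i′ → adj J (i ↑ˡ suc k) (i′ ↑ˡ suc k)) ∣ ≡⟨ ∣N∩∁rightBlock∣ p (suc k) J (i ↑ˡ suc k) ⟨
    ∣ N J (i ↑ˡ suc k) ∩ ∁ (rightBlock p (suc k)) ∣    ∎
  ... | right j = contradiction (∈tabulate⁺ (inRight-↑ʳ p j)) u∉

isKTRDS-rightBlock⇒kJoin : ∀ p (J : Graph (p + suc k)) → IsKTRDS J k (rightBlock p (suc k)) →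
  MinDegGE (comap (_↑ˡ suc k) J) k × IsKJoin k (comap (_↑ˡ suc k) J) (K (suc k)) J
isKTRDS-rightBlock⇒kJoin {k} p J (dom , restr) =
  δF≥k , n≤1+n k , (λ i j → refl) , J[K] , F→K
  where
  δF≥k : MinDegGE (comap (_↑ˡ suc k) J) k
  δF≥k i = subst (k ≤_) (∣N∩∁rightBlock∣ p (suc k) J (i ↑ˡ suc k))
    (restr (i ↑ˡ suc k) (λ i∈ → contradiction (trans (sym (∈tabulate⁻ i∈)) (inRight-↑ˡ p i)) λ ()))
  F→K : ∀ i → k ≤ ∣ tabulate (λ j → adj J (i ↑ˡ suc k) (p ↑ʳ j)) ∣
  F→K i = subst (k ≤_) (∣N∩rightBlock∣ p (suc k) J (i ↑ˡ suc k)) (dom (i ↑ˡ suc k))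
  J[K] : ∀ i j → adj J (p ↑ʳ i) (p ↑ʳ j) ≡ adj (K (suc k)) i j
  J[K] i j with i ≟ j
  ... | yes refl = adj-irrefl J (p ↑ʳ i)
  ... | no i≢j = kTupleTotalDominating∧∣S∣≡1+k⇒clique J dom (∣rightBlock∣ p (suc k))
    (∈tabulate⁺ (inRight-↑ʳ p i)) (∈tabulate⁺ (inRight-↑ʳ p j)) (i≢j ∘ ↑ʳ-injective p i j)

-- Lists the vertices outside s before those in s, matching the vertex order of a k-join.
record Separation (s : Fin n → Bool) : Set where
  field
    a b       : ℕ
    π         : Fin n ↔ (Fin a ⊎ Fin b)
    separates : ∀ u → s (Inverse.from π u) ≡ isRight u

consˡ : Fin n ↔ (Fin m ⊎ Fin p) → Fin (suc n) ↔ (Fin (suc m) ⊎ Fin p)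
consˡ {n} {m} {p} π = mk↔ₛ′ to′ from′ to∘from from∘to
  where
  open Inverse π
  to′ : Fin (suc n) → Fin (suc m) ⊎ Fin p
  to′ zero    = inj₁ zero
  to′ (suc x) = map₁ suc (to x)
  from′ : Fin (suc m) ⊎ Fin p → Fin (suc n)
  from′ (inj₁ zero)    = zero
  from′ (inj₁ (suc i)) = suc (from (inj₁ i))
  from′ (inj₂ j)       = suc (from (inj₂ j))
  from′-map₁ : ∀ u → from′ (map₁ suc u) ≡ suc (from u)
  from′-map₁ (inj₁ i) = refl
  from′-map₁ (inj₂ j) = refl
  to∘from : ∀ u → to′ (from′ u) ≡ u
  to∘from (inj₁ zero)    = refl
  to∘from (inj₁ (suc i)) = cong (map₁ suc) (strictlyInverseˡ (inj₁ i))
  to∘from (inj₂ j)       = cong (map₁ suc) (strictlyInverseˡ (inj₂ j))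
  from∘to : ∀ x → from′ (to′ x) ≡ x
  from∘to zero    = refl
  from∘to (suc x) = trans (from′-map₁ (to x)) (cong suc (strictlyInverseʳ x))

consʳ : Fin n ↔ (Fin m ⊎ Fin p) → Fin (suc n) ↔ (Fin m ⊎ Fin (suc p))
consʳ π = ↔-trans (consˡ (↔-trans π (⊎-comm _ _))) (⊎-comm _ _)

separate : (s : Fin n → Bool) → Separation s
separate {zero} s = record
  { a = 0 ; b = 0
  ; π = mk↔ₛ′ (λ ()) [ (λ ()) , (λ ()) ]′ (λ { (inj₁ ()) ; (inj₂ ()) }) (λ ())
  ; separates = λ { (inj₁ ()) ; (inj₂ ()) }
  }
separate {suc n} s with s zero in s₀ | separate (s ∘ suc)
... | false | record { a = a ; b = b ; π = π ; separates = sep } = record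
  { a = suc a ; b = b ; π = consˡ π
  ; separates = λ { (inj₁ zero) → s₀ ; (inj₁ (suc i)) → sep (inj₁ i) ; (inj₂ j) → sep (inj₂ j) }
  }
... | true | record { a = a ; b = b ; π = π ; separates = sep } = record
  { a = a ; b = suc b ; π = consʳ π
  ; separates = λ { (inj₁ i) → sep (inj₁ i) ; (inj₂ zero) → s₀ ; (inj₂ (suc j)) → sep (inj₂ j) }
  }

module _ {s : Fin n → Bool} (σ : Separation s) where
  open Separation σ

  blockPermutation : Permutation n (a + b)
  blockPermutation = ↔-trans π (↔-sym +↔⊎)

  separates-block : ∀ v → s (blockPermutation ⟨$⟩ˡ v) ≡ inRight a v
  separates-block v = separates (splitAt a v)

  ∣tabulate∣-separation : ∣ tabulate s ∣ ≡ b
  ∣tabulate∣-separation = begin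
    ∣ tabulate s ∣                               ≡⟨ ∣tabulate∣-permute (↔-sym blockPermutation) s ⟩
    ∣ tabulate (s ∘ (blockPermutation ⟨$⟩ˡ_)) ∣  ≡⟨ cong ∣_∣ (tabulate-cong separates-block) ⟩
    ∣ rightBlock a b ∣                           ≡⟨ ∣rightBlock∣ a b ⟩
    b                                            ∎
    where open ≡-Reasoning

IsKJoinOfClique : Graph n → ℕ → Set
IsKJoinOfClique G k = Σ ℕ λ p → Σ (Graph p) λ F → MinDegGE F k × IsKJoinOf k G F (K (suc k))

K-isKJoin : ∀ k → IsKJoin k (K 0) (K (suc k)) (K (suc k))
K-isKJoin k = n≤1+n k , (λ ()) , (λ i j → refl) , (λ ())

separatedKTRDS⇒kJoin : (G : Graph n) {s : Fin n → Bool} (σ : Separation s) →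
  Separation.b σ ≡ suc k → IsKTRDS G k (tabulate s) → IsKJoinOfClique G k
separatedKTRDS⇒kJoin {k = k} G σ@record { a = a } refl s-kTRDS =
  a , comap (_↑ˡ suc k) J , proj₁ kJoin , J , proj₂ kJoin , G≅J
  where
  J : Graph (a + suc k)
  J = comap (blockPermutation σ ⟨$⟩ˡ_) G
  G≅J : G ≅ J
  G≅J = ≅-comap (blockPermutation σ) G
  kJoin : MinDegGE (comap (_↑ˡ suc k) J) k × IsKJoin k (comap (_↑ˡ suc k) J) (K (suc k)) J
  kJoin = isKTRDS-rightBlock⇒kJoin a J
    (subst (IsKTRDS J k) (tabulate-cong (separates-block σ)) (isKTRDS-≅ (≅-sym G≅J) s-kTRDS))

isKTRDS∧∣S∣≡1+k⇒kJoin : (G : Graph n) {S : Subset n} → IsKTRDS G k S → ∣ S ∣ ≡ suc k → IsKJoinOfClique G k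
isKTRDS∧∣S∣≡1+k⇒kJoin {k = k} G {S} S-kTRDS ∣S∣≡1+k = separatedKTRDS⇒kJoin G σ b≡1+k
  (subst (IsKTRDS G k) (sym (tabulate∘lookup S)) S-kTRDS)
  where
  σ = separate (lookup S)
  b≡1+k : Separation.b σ ≡ suc k
  b≡1+k = trans (sym (∣tabulate∣-separation σ)) (trans (cong ∣_∣ (tabulate∘lookup S)) ∣S∣≡1+k)

kJoin⇒kTRDNumber≡1+k : (G : Graph n) → 1 ≤ k → IsKJoinOfClique G k → KTRDNumberIs G k (suc k)
kJoin⇒kTRDNumber≡1+k {k = k} G 1≤k (p , F , δF≥k , J , kJoin , G≅J) =
  ( tabulate (inRight p ∘ to)
  , isKTRDS-≅ G≅J {t = inRight p {suc k}} (kJoin⇒isKTRDS-rightBlock p F J δF≥k kJoin)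
  , trans (∣tabulate∣-≅ G≅J (inRight p {suc k})) (∣rightBlock∣ p (suc k)))
  , λ S S-kTRDS → kTupleTotalDominating⇒k<∣S∣ G 1≤k (from (p ↑ʳ zero)) (proj₁ S-kTRDS)
  where open _≅_ G≅J

-- δ(G) ≥ k only makes γ^r_{×k,t}(G) meaningful; neither direction uses it.
corollary3p2 : (k : ℕ) → 1 ≤ k → (n : ℕ) → (G : Graph n) → MinDegGE G k →
    KTRDNumberIs G k (suc k) ⇔
      (G ≅ K (suc k) ⊎
        Σ ℕ (λ p → Σ (Graph p) (λ F → MinDegGE F k × IsKJoinOf k G F (K (suc k)))))
corollary3p2 k 1≤k n G _ = mk⇔
  (λ (((S , S-kTRDS , ∣S∣≡1+k) , _)) → inj₂ (isKTRDS∧∣S∣≡1+k⇒kJoin G S-kTRDS ∣S∣≡1+k))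
  (kJoin⇒kTRDNumber≡1+k G 1≤k ∘ [ (λ G≅K → 0 , K 0 , (λ ()) , K (suc k) , K-isKJoin k , G≅K) , id ]′)
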